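{- Let $1\le k\le n$. For all integers $n_1,n_2,k_1,k_2$ with $n_1+n_2=n$, $k_1+k_2=k$, $1\le k_1\le n_1$ and $1\le k_2\le n_2$, we have $\mathrm{M}(n,I_k)\ge \mathrm{M}(n_1,I_{k_1})+\mathrm{M}(n_2,I_{k_2})$. Equivalently, $\mathrm{M}(n,I_k)$ is at least the maximum of $\mathrm{M}(n_1,I_{k_1})+\mathrm{M}(n_2,I_{k_2})$ over all such $n_1,n_2,k_1,k_2$.
   Context: All matrices are $(0,1)$-matrices; $I_k$ is the $k\times k$ identity matrix. An $n\times n$ matrix $A$ ($n\ge k$) is strongly $I_k$-forcing if for every $1$-entry $o$ of $A$ there is a $k\times k$ submatrix of $A$ (any $k$ rows and any $k$ columns, order kept) exactly equal to $I_k$ that contains $o$. $\mathrm{M}(n,I_k)$ is the maximum number of $1$-entries of an $n\times n$ strongly $I_k$-forcing matrix. -}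

module Defs where

open import Data.Nat using (ℕ; zero; suc; _+_; _≤_)
open import Data.Fin using (Fin; _<_; _≟_)
open import Data.Bool using (Bool; true; false; if_then_else_)
open import Data.Product using (Σ; ∃; _×_; _,_)
open import Relation.Nullary.Decidable using (⌊_⌋)
open import Relation.Binary.PropositionalEquality using (_≡_)

Matrix : ℕ → Set
Matrix n = Fin n → Fin n → Bool

∑ : (m : ℕ) → (Fin m → ℕ) → ℕ
∑ zero    f = 0
∑ (suc m) f = f Fin.zero + ∑ m (λ i → f (Fin.suc i))

ones : ∀ {n} → Matrix n → ℕ
ones {n} A = ∑ n (λ i → ∑ n (λ j → if A i j then 1 else 0))

StrictlyIncreasing : ∀ {k n} → (Fin k → Fin n) → Set
StrictlyIncreasing {k} f = ∀ (i j : Fin k) → i < j → f i < f j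

identity : (k : ℕ) → Fin k → Fin k → Bool
identity k i j = ⌊ i ≟ j ⌋

IkCopyThrough : ∀ {n} (k : ℕ) → Matrix n → Fin n → Fin n → Set
IkCopyThrough {n} k A a b =
  Σ (Fin k → Fin n) λ r → Σ (Fin k → Fin n) λ c →
    StrictlyIncreasing r × StrictlyIncreasing c ×
    (∀ i j → A (r i) (c j) ≡ identity k i j) ×
    Σ (Fin k) λ i → Σ (Fin k) λ j → (r i ≡ a) × (c j ≡ b)

StronglyForcing : ∀ {n} (k : ℕ) → Matrix n → Set
StronglyForcing {n} k A = ∀ (a b : Fin n) → A a b ≡ true → IkCopyThrough k A a b

-- m = M(n, I_k): m is the maximum number of 1-entries of an n × n
-- strongly I_k-forcing matrix.
IsM : (n k m : ℕ) → Set
IsM n k m =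
  (Σ (Matrix n) λ A → StronglyForcing k A × ones A ≡ m) ×
  (∀ (A : Matrix n) → StronglyForcing k A → ones A ≤ m)

-- Put a maximal strongly I_k₁-forcing n₁ × n₁ matrix A₁ and a maximal strongly
-- I_k₂-forcing n₂ × n₂ matrix A₂ on the diagonal of an n × n matrix.  A 1-entry of
-- A₁ lies in a copy of I_k₁ inside A₁; extended by any copy of I_k₂ inside A₂ (one
-- exists because the padded identity shows M(n₂, I_k₂) ≥ 1), it becomes a copy of
-- I_k through that entry, and symmetrically for the entries of A₂.
module Submission where

open import Defs
open import Data.Bool using (Bool; true; false; if_then_else_; _∧_)
open import Data.Bool.Properties using (∧-identityʳ)
open import Data.Empty using (⊥-elim)
open import Data.Fin as Fin
  using (Fin; zero; suc; toℕ; _↑ˡ_; _↑ʳ_; splitAt; join; inject≤; fromℕ<)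
open import Data.Fin.Properties
  using ( toℕ-↑ˡ; toℕ-↑ʳ; ↑ˡ-injective; ↑ʳ-injective; splitAt-↑ˡ; splitAt-↑ʳ
        ; splitAt-join; join-splitAt; toℕ<n; toℕ-injective; <⇒≢; <-asym
        ; toℕ-inject≤; inject≤-injective; toℕ-fromℕ<)
open import Data.Nat as ℕ using (ℕ; zero; suc; _+_; _≤_; s≤s; z≤n)
open import Data.Nat.Properties
  using ( ≤-trans; m≤m+n; m≤n+m; <-≤-trans; +-monoʳ-<; +-cancelˡ-<; +-assoc; +-identityʳ
        ; module ≤-Reasoning)
open import Data.Product using (∃; _,_)
open import Data.Sum as Sum using (_⊎_; inj₁; inj₂)
open import Data.Sum.Relation.Binary.LeftOrder using (_⊎-<_; ₁∼₂; ₁∼₁; ₂∼₂)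
open import Function using (_∘_; _⇔_; mk⇔)
open import Relation.Nullary using (Dec; yes; no; ¬_)
open import Relation.Nullary.Decidable using (⌊_⌋; isYes≗does; does-⇔; dec-false)
open import Relation.Binary.PropositionalEquality
  using (_≡_; _≢_; refl; sym; trans; cong; cong₂; subst; subst₂; module ≡-Reasoning)

private
  variable
    k k₁ k₂ m n n₁ n₂ : ℕ

⌊⌋-cong : ∀ {P Q : Set} → P ⇔ Q → (p? : Dec P) (q? : Dec Q) → ⌊ p? ⌋ ≡ ⌊ q? ⌋
⌊⌋-cong P⇔Q p? q? = trans (isYes≗does p?) (trans (does-⇔ P⇔Q p? q?) (sym (isYes≗does q?)))

⌊⌋-false : ∀ {P : Set} (p? : Dec P) → ¬ P → ⌊ p? ⌋ ≡ false
⌊⌋-false p? ¬p = trans (isYes≗does p?) (dec-false p? ¬p)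

∑-cong : ∀ m {f g : Fin m → ℕ} → (∀ i → f i ≡ g i) → ∑ m f ≡ ∑ m g
∑-cong zero    f≗g = refl
∑-cong (suc m) f≗g = cong₂ _+_ (f≗g zero) (∑-cong m (f≗g ∘ suc))

∑-zero : ∀ m → ∑ m (λ _ → 0) ≡ 0
∑-zero zero    = refl
∑-zero (suc m) = ∑-zero m

∑-splitAt : ∀ m n (h : Fin m ⊎ Fin n → ℕ) →
            ∑ (m + n) (h ∘ splitAt m) ≡ ∑ m (h ∘ inj₁) + ∑ n (h ∘ inj₂)
∑-splitAt zero    n h = refl
∑-splitAt (suc m) n h =
  trans (cong (h (inj₁ zero) +_) (∑-splitAt m n (h ∘ Sum.map₁ suc)))
        (sym (+-assoc (h (inj₁ zero)) _ _))

term≤∑ : ∀ m (f : Fin m → ℕ) i → f i ≤ ∑ m f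
term≤∑ (suc m) f zero    = m≤m+n _ _
term≤∑ (suc m) f (suc i) = ≤-trans (term≤∑ m (f ∘ suc) i) (m≤n+m _ _)

∑-positive⇒∃-positive : ∀ m (f : Fin m → ℕ) → 1 ≤ ∑ m f → ∃ λ i → 1 ≤ f i
∑-positive⇒∃-positive (suc m) f 1≤∑ with f zero in eq
... | suc _ = zero , subst (1 ≤_) (sym eq) (s≤s z≤n)
... | zero  with ∑-positive⇒∃-positive m (f ∘ suc) 1≤∑
...   | i , 1≤fi = suc i , 1≤fi

bit : Bool → ℕ
bit b = if b then 1 else 0

entry⇒ones-positive : (A : Matrix n) (a b : Fin n) → A a b ≡ true → 1 ≤ ones A
entry⇒ones-positive {n} A a b Aab≡true = begin
  1                        ≡⟨ cong bit Aab≡true ⟨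
  bit (A a b)              ≤⟨ term≤∑ n (bit ∘ A a) b ⟩
  ∑ n (bit ∘ A a)          ≤⟨ term≤∑ n (λ i → ∑ n (bit ∘ A i)) a ⟩
  ones A                   ∎
  where open ≤-Reasoning

ones-positive⇒entry : (A : Matrix n) → 1 ≤ ones A → ∃ λ a → ∃ λ b → A a b ≡ true
ones-positive⇒entry {n} A 1≤ones with ∑-positive⇒∃-positive n _ 1≤ones
... | a , 1≤row with ∑-positive⇒∃-positive n (bit ∘ A a) 1≤row
...   | b , 1≤bit = a , b , bit-positive (A a b) 1≤bit
  where
  bit-positive : ∀ x → 1 ≤ bit x → x ≡ true
  bit-positive true _ = refl

blockDiagonal : Matrix n₁ → Matrix n₂ → Fin n₁ ⊎ Fin n₂ → Fin n₁ ⊎ Fin n₂ → Bool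
blockDiagonal A B (inj₁ x) (inj₁ y) = A x y
blockDiagonal A B (inj₂ x) (inj₂ y) = B x y
blockDiagonal A B _        _        = false

_⊕_ : Matrix n₁ → Matrix n₂ → Matrix (n₁ + n₂)
_⊕_ {n₁} A B a b = blockDiagonal A B (splitAt n₁ a) (splitAt n₁ b)

⊕-join : (A : Matrix n₁) (B : Matrix n₂) (s t : Fin n₁ ⊎ Fin n₂) →
         (A ⊕ B) (join n₁ n₂ s) (join n₁ n₂ t) ≡ blockDiagonal A B s t
⊕-join {n₁} {n₂} A B s t =
  cong₂ (blockDiagonal A B) (splitAt-join n₁ n₂ s) (splitAt-join n₁ n₂ t)

ones-⊕ : (A : Matrix n₁) (B : Matrix n₂) → ones (A ⊕ B) ≡ ones A + ones B
ones-⊕ {n₁} {n₂} A B = begin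
  ones (A ⊕ B)
    ≡⟨ ∑-splitAt n₁ n₂ row ⟩
  ∑ n₁ (row ∘ inj₁) + ∑ n₂ (row ∘ inj₂)
    ≡⟨ cong₂ _+_ (∑-cong n₁ (∑-splitAt n₁ n₂ ∘ entry ∘ inj₁))
                 (∑-cong n₂ (∑-splitAt n₁ n₂ ∘ entry ∘ inj₂)) ⟩
  ∑ n₁ (λ x → ∑ n₁ (bit ∘ A x) + ∑ n₂ (λ _ → 0)) +
  ∑ n₂ (λ x → ∑ n₁ (λ _ → 0) + ∑ n₂ (bit ∘ B x))
    ≡⟨ cong₂ _+_ (∑-cong n₁ (λ x → trans (cong (_ +_) (∑-zero n₂)) (+-identityʳ _)))
                 (∑-cong n₂ (λ x → cong (_+ _) (∑-zero n₁))) ⟩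
  ones A + ones B ∎
  where
  open ≡-Reasoning
  entry : Fin n₁ ⊎ Fin n₂ → Fin n₁ ⊎ Fin n₂ → ℕ
  entry s t = bit (blockDiagonal A B s t)
  row : Fin n₁ ⊎ Fin n₂ → ℕ
  row s = ∑ (n₁ + n₂) (entry s ∘ splitAt n₁)

_<⊎_ : Fin m ⊎ Fin n → Fin m ⊎ Fin n → Set
_<⊎_ = Fin._<_ ⊎-< Fin._<_

join-strictMono : ∀ {s t : Fin m ⊎ Fin n} → s <⊎ t → join m n s Fin.< join m n t
join-strictMono {m} {n} (₁∼₂ {x} {y})
  rewrite toℕ-↑ˡ x n | toℕ-↑ʳ m y = <-≤-trans (toℕ<n x) (m≤m+n m (toℕ y))
join-strictMono {m} {n} (₁∼₁ {x} {y} x<y)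
  rewrite toℕ-↑ˡ x n | toℕ-↑ˡ y n = x<y
join-strictMono {m} {n} (₂∼₂ {x} {y} x<y)
  rewrite toℕ-↑ʳ m x | toℕ-↑ʳ m y = +-monoʳ-< m x<y

join-reflects-< : ∀ (s t : Fin m ⊎ Fin n) → join m n s Fin.< join m n t → s <⊎ t
join-reflects-< {m} {n} (inj₁ x) (inj₁ y) x<y
  rewrite toℕ-↑ˡ x n | toℕ-↑ˡ y n = ₁∼₁ x<y
join-reflects-< {m} {n} (inj₂ x) (inj₂ y) x<y
  rewrite toℕ-↑ʳ m x | toℕ-↑ʳ m y = ₂∼₂ (+-cancelˡ-< m _ _ x<y)
join-reflects-< (inj₁ x) (inj₂ y) _   = ₁∼₂
join-reflects-< (inj₂ x) (inj₁ y) y<x = ⊥-elim (<-asym y<x (join-strictMono ₁∼₂))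

splitAt-strictMono : ∀ (i j : Fin (m + n)) → i Fin.< j → splitAt m i <⊎ splitAt m j
splitAt-strictMono {m} {n} i j i<j =
  join-reflects-< (splitAt m i) (splitAt m j)
    (subst₂ Fin._<_ (sym (join-splitAt m n i)) (sym (join-splitAt m n j)) i<j)

_⊕ᶠ_ : (Fin k₁ → Fin n₁) → (Fin k₂ → Fin n₂) → Fin (k₁ + k₂) → Fin (n₁ + n₂)
_⊕ᶠ_ {k₁} {n₁} {_} {n₂} f g i = join n₁ n₂ (Sum.map f g (splitAt k₁ i))

⊕ᶠ-↑ˡ : (f : Fin k₁ → Fin n₁) (g : Fin k₂ → Fin n₂) (i : Fin k₁) →
        (f ⊕ᶠ g) (i ↑ˡ k₂) ≡ f i ↑ˡ n₂
⊕ᶠ-↑ˡ {k₁} {_} {k₂} {n₂} f g i = cong (join _ n₂ ∘ Sum.map f g) (splitAt-↑ˡ k₁ i k₂)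

⊕ᶠ-↑ʳ : (f : Fin k₁ → Fin n₁) (g : Fin k₂ → Fin n₂) (i : Fin k₂) →
        (f ⊕ᶠ g) (k₁ ↑ʳ i) ≡ n₁ ↑ʳ g i
⊕ᶠ-↑ʳ {k₁} {n₁} {k₂} f g i = cong (join n₁ _ ∘ Sum.map f g) (splitAt-↑ʳ k₁ k₂ i)

⊕ᶠ-strictlyIncreasing : {f : Fin k₁ → Fin n₁} {g : Fin k₂ → Fin n₂} →
  StrictlyIncreasing f → StrictlyIncreasing g → StrictlyIncreasing (f ⊕ᶠ g)
⊕ᶠ-strictlyIncreasing {k₁} {f = f} {g} f↑ g↑ i j i<j =
  join-strictMono (map-strictMono (splitAt-strictMono {k₁} i j i<j))
  where
  map-strictMono : ∀ {s t} → s <⊎ t → Sum.map f g s <⊎ Sum.map f g t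
  map-strictMono ₁∼₂       = ₁∼₂
  map-strictMono (₁∼₁ x<y) = ₁∼₁ (f↑ _ _ x<y)
  map-strictMono (₂∼₂ x<y) = ₂∼₂ (g↑ _ _ x<y)

⊕-identity : ∀ (i j : Fin (k₁ + k₂)) →
             (identity k₁ ⊕ identity k₂) i j ≡ identity (k₁ + k₂) i j
⊕-identity {k₁} {k₂} i j = begin
  blockDiagonal (identity k₁) (identity k₂) (splitAt k₁ i) (splitAt k₁ j)
    ≡⟨ blockDiagonal-identity (splitAt k₁ i) (splitAt k₁ j) ⟩
  ⌊ join k₁ k₂ (splitAt k₁ i) Fin.≟ join k₁ k₂ (splitAt k₁ j) ⌋
    ≡⟨ cong₂ (λ a b → ⌊ a Fin.≟ b ⌋) (join-splitAt k₁ k₂ i) (join-splitAt k₁ k₂ j) ⟩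
  identity (k₁ + k₂) i j ∎
  where
  open ≡-Reasoning
  ↑ˡ≢↑ʳ : ∀ x y → x ↑ˡ k₂ ≢ k₁ ↑ʳ y
  ↑ˡ≢↑ʳ x y = <⇒≢ (join-strictMono ₁∼₂)
  blockDiagonal-identity : ∀ s t →
    blockDiagonal (identity k₁) (identity k₂) s t ≡ ⌊ join k₁ k₂ s Fin.≟ join k₁ k₂ t ⌋
  blockDiagonal-identity (inj₁ x) (inj₁ y) =
    ⌊⌋-cong (mk⇔ (cong (_↑ˡ k₂)) (↑ˡ-injective k₂ x y)) _ _
  blockDiagonal-identity (inj₂ x) (inj₂ y) =
    ⌊⌋-cong (mk⇔ (cong (k₁ ↑ʳ_)) (↑ʳ-injective k₁ x y)) _ _
  blockDiagonal-identity (inj₁ x) (inj₂ y) = sym (⌊⌋-false _ (↑ˡ≢↑ʳ x y))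
  blockDiagonal-identity (inj₂ x) (inj₁ y) = sym (⌊⌋-false _ (↑ˡ≢↑ʳ y x ∘ sym))

record IkCopy (k : ℕ) (A : Matrix n) : Set where
  field
    rows cols       : Fin k → Fin n
    rows-increasing : StrictlyIncreasing rows
    cols-increasing : StrictlyIncreasing cols
    entries         : ∀ i j → A (rows i) (cols j) ≡ identity k i j

open IkCopy

forget : {A : Matrix n} {a b : Fin n} → IkCopyThrough k A a b → IkCopy k A
forget (r , c , r↑ , c↑ , e , _) = record
  { rows = r ; cols = c ; rows-increasing = r↑ ; cols-increasing = c↑ ; entries = e }

through : {A : Matrix n} {a b : Fin n} (C : IkCopy k A) (i j : Fin k) →
          rows C i ≡ a → cols C j ≡ b → IkCopyThrough k A a b
through C i j rᵢ≡a cⱼ≡b =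
  rows C , cols C , rows-increasing C , cols-increasing C , entries C , i , j , rᵢ≡a , cⱼ≡b

IkCopy-ones-positive : {A : Matrix n} → IkCopy (suc k) A → 1 ≤ ones A
IkCopy-ones-positive {A = A} C = entry⇒ones-positive A _ _ (entries C zero zero)

_⊕ᶜ_ : {A₁ : Matrix n₁} {A₂ : Matrix n₂} →
       IkCopy k₁ A₁ → IkCopy k₂ A₂ → IkCopy (k₁ + k₂) (A₁ ⊕ A₂)
_⊕ᶜ_ {n₁} {n₂} {k₁} {k₂} {A₁} {A₂} C₁ C₂ = record
  { rows            = rows C₁ ⊕ᶠ rows C₂
  ; cols            = cols C₁ ⊕ᶠ cols C₂
  ; rows-increasing = ⊕ᶠ-strictlyIncreasing (rows-increasing C₁) (rows-increasing C₂)
  ; cols-increasing = ⊕ᶠ-strictlyIncreasing (cols-increasing C₁) (cols-increasing C₂)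
  ; entries         = λ i j → begin
      (A₁ ⊕ A₂) (join n₁ n₂ (rowsᵢ i)) (join n₁ n₂ (colsᵢ j))
        ≡⟨ ⊕-join A₁ A₂ (rowsᵢ i) (colsᵢ j) ⟩
      blockDiagonal A₁ A₂ (rowsᵢ i) (colsᵢ j)
        ≡⟨ blockDiagonal-entries (splitAt k₁ i) (splitAt k₁ j) ⟩
      (identity k₁ ⊕ identity k₂) i j
        ≡⟨ ⊕-identity {k₁} i j ⟩
      identity (k₁ + k₂) i j ∎
  }
  where
  open ≡-Reasoning
  rowsᵢ colsᵢ : Fin (k₁ + k₂) → Fin n₁ ⊎ Fin n₂
  rowsᵢ i = Sum.map (rows C₁) (rows C₂) (splitAt k₁ i)
  colsᵢ j = Sum.map (cols C₁) (cols C₂) (splitAt k₁ j)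
  blockDiagonal-entries : ∀ s t →
    blockDiagonal A₁ A₂ (Sum.map (rows C₁) (rows C₂) s) (Sum.map (cols C₁) (cols C₂) t) ≡
    blockDiagonal (identity k₁) (identity k₂) s t
  blockDiagonal-entries (inj₁ x) (inj₁ y) = entries C₁ x y
  blockDiagonal-entries (inj₂ x) (inj₂ y) = entries C₂ x y
  blockDiagonal-entries (inj₁ x) (inj₂ y) = refl
  blockDiagonal-entries (inj₂ x) (inj₁ y) = refl

⊕-through-↑ˡ : {A₁ : Matrix n₁} {A₂ : Matrix n₂} {x y : Fin n₁} →
  IkCopyThrough k₁ A₁ x y → IkCopy k₂ A₂ →
  IkCopyThrough (k₁ + k₂) (A₁ ⊕ A₂) (x ↑ˡ n₂) (y ↑ˡ n₂)
⊕-through-↑ˡ {n₂ = n₂} {k₂ = k₂} T@(r , c , _ , _ , _ , i , j , rᵢ≡x , cⱼ≡y) C₂ =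
  through (forget T ⊕ᶜ C₂) (i ↑ˡ k₂) (j ↑ˡ k₂)
    (trans (⊕ᶠ-↑ˡ r (rows C₂) i) (cong (_↑ˡ n₂) rᵢ≡x))
    (trans (⊕ᶠ-↑ˡ c (cols C₂) j) (cong (_↑ˡ n₂) cⱼ≡y))

⊕-through-↑ʳ : {A₁ : Matrix n₁} {A₂ : Matrix n₂} {x y : Fin n₂} →
  IkCopy k₁ A₁ → IkCopyThrough k₂ A₂ x y →
  IkCopyThrough (k₁ + k₂) (A₁ ⊕ A₂) (n₁ ↑ʳ x) (n₁ ↑ʳ y)
⊕-through-↑ʳ {n₁ = n₁} {k₁ = k₁} C₁ T@(r , c , _ , _ , _ , i , j , rᵢ≡x , cⱼ≡y) =
  through (C₁ ⊕ᶜ forget T) (k₁ ↑ʳ i) (k₁ ↑ʳ j)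
    (trans (⊕ᶠ-↑ʳ (rows C₁) r i) (cong (n₁ ↑ʳ_) rᵢ≡x))
    (trans (⊕ᶠ-↑ʳ (cols C₁) c j) (cong (n₁ ↑ʳ_) cⱼ≡y))

⊕-stronglyForcing : {A₁ : Matrix n₁} {A₂ : Matrix n₂} →
  StronglyForcing k₁ A₁ → StronglyForcing k₂ A₂ → IkCopy k₁ A₁ → IkCopy k₂ A₂ →
  StronglyForcing (k₁ + k₂) (A₁ ⊕ A₂)
⊕-stronglyForcing {n₁} {n₂} {k₁} {k₂} {A₁} {A₂} F₁ F₂ C₁ C₂ a b Aab≡true =
  subst₂ (IkCopyThrough (k₁ + k₂) (A₁ ⊕ A₂)) (join-splitAt n₁ n₂ a) (join-splitAt n₁ n₂ b)
    (forcing (splitAt n₁ a) (splitAt n₁ b) Aab≡true)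
  where
  forcing : ∀ s t → blockDiagonal A₁ A₂ s t ≡ true →
            IkCopyThrough (k₁ + k₂) (A₁ ⊕ A₂) (join n₁ n₂ s) (join n₁ n₂ t)
  forcing (inj₁ x) (inj₁ y) A₁xy≡true = ⊕-through-↑ˡ (F₁ x y A₁xy≡true) C₂
  forcing (inj₂ x) (inj₂ y) A₂xy≡true = ⊕-through-↑ʳ C₁ (F₂ x y A₂xy≡true)
  forcing (inj₁ x) (inj₂ y) ()
  forcing (inj₂ x) (inj₁ y) ()

paddedIdentity : (k : ℕ) → Matrix n
paddedIdentity k a b = ⌊ a Fin.≟ b ⌋ ∧ ⌊ toℕ a ℕ.<? k ⌋

paddedIdentity-copy : k ≤ n → IkCopy k (paddedIdentity {n} k)
paddedIdentity-copy {k} {n} k≤n = record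
  { rows = embed ; cols = embed
  ; rows-increasing = embed-increasing ; cols-increasing = embed-increasing
  ; entries = entries-embed }
  where
  embed : Fin k → Fin n
  embed i = inject≤ i k≤n
  embed-increasing : StrictlyIncreasing embed
  embed-increasing i j i<j rewrite toℕ-inject≤ i k≤n | toℕ-inject≤ j k≤n = i<j
  entries-embed : ∀ i j → paddedIdentity k (embed i) (embed j) ≡ identity k i j
  entries-embed i j with toℕ (embed i) ℕ.<? k
  ... | no  i≮k = ⊥-elim (i≮k (subst (ℕ._< k) (sym (toℕ-inject≤ i k≤n)) (toℕ<n i)))
  ... | yes _   = trans (∧-identityʳ _)
                    (⌊⌋-cong (mk⇔ (inject≤-injective k≤n k≤n i j) (cong embed)) _ _)

paddedIdentity-stronglyForcing : k ≤ n → StronglyForcing k (paddedIdentity {n} k)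
paddedIdentity-stronglyForcing {k} {n} k≤n a b Pab≡true
  with a Fin.≟ b | toℕ a ℕ.<? k | Pab≡true
... | yes refl | yes a<k | _ = through (paddedIdentity-copy k≤n) i i embed-i≡a embed-i≡a
  where
  i : Fin k
  i = fromℕ< a<k
  embed-i≡a : inject≤ i k≤n ≡ a
  embed-i≡a = toℕ-injective (trans (toℕ-inject≤ i k≤n) (toℕ-fromℕ< a<k))
... | yes _ | no _ | ()
... | no _  | _    | ()

maximiser-has-copy : 1 ≤ k → k ≤ n → (A : Matrix n) → StronglyForcing k A →
  (∀ (B : Matrix n) → StronglyForcing k B → ones B ≤ ones A) → IkCopy k A
maximiser-has-copy (s≤s z≤n) k≤n A F maximal =
  let a , b , Aab≡true = ones-positive⇒entry A 1≤ones in forget (F a b Aab≡true)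
  where
  1≤ones : 1 ≤ ones A
  1≤ones = ≤-trans (IkCopy-ones-positive (paddedIdentity-copy k≤n))
                   (maximal _ (paddedIdentity-stronglyForcing k≤n))

proposition1 : ∀ (n k n₁ n₂ k₁ k₂ m m₁ m₂ : ℕ) →
    1 ≤ k → k ≤ n →
    n₁ + n₂ ≡ n → k₁ + k₂ ≡ k →
    1 ≤ k₁ → k₁ ≤ n₁ → 1 ≤ k₂ → k₂ ≤ n₂ →
    IsM n k m → IsM n₁ k₁ m₁ → IsM n₂ k₂ m₂ →
    m₁ + m₂ ≤ m
proposition1 n k n₁ n₂ k₁ k₂ m m₁ m₂ _ _ refl refl 1≤k₁ k₁≤n₁ 1≤k₂ k₂≤n₂
  (_ , maximal) ((A₁ , F₁ , refl) , maximal₁) ((A₂ , F₂ , refl) , maximal₂) = begin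
  ones A₁ + ones A₂  ≡⟨ ones-⊕ A₁ A₂ ⟨
  ones (A₁ ⊕ A₂)     ≤⟨ maximal (A₁ ⊕ A₂) (⊕-stronglyForcing F₁ F₂ C₁ C₂) ⟩
  m                  ∎
  where
  open ≤-Reasoning
  C₁ : IkCopy k₁ A₁
  C₁ = maximiser-has-copy 1≤k₁ k₁≤n₁ A₁ F₁ maximal₁
  C₂ : IkCopy k₂ A₂
  C₂ = maximiser-has-copy 1≤k₂ k₂≤n₂ A₂ F₂ maximal₂
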